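{- Let $q=2^h$ and let $\lambda$ be a primitive element of $\mathbb{F}_q$ whose minimal polynomial over $\mathbb{F}_2$ has the form $x^h+c_{h-3}x^{h-3}+\dots+c_1x+c_0$ (no terms of degree $h-1$ and $h-2$). Write each $\mu\in\mathbb{F}_q$ uniquely as $\mu=\sum_{i=0}^{h-1}\mu_i\lambda^i$ with $\mu_i\in\mathbb{F}_2$. For $c\in\mathbb{F}_2$ let $S_A=\{(\mu,1,0)\mid \mu_{h-2}=0,\mu_{h-3}=1\}$, $S_B=\{(\mu,0,1)\mid \mu_{h-1}=0,\mu_{h-2}=1\}$, $S_{C,c}=\{(\mu,1,1)\mid \mu_{h-2}=0,\sum_{i=0}^{h-3}\mu_i=c\}$, $S_{D,c}=\{(\mu,\lambda,1)\mid \mu_{h-1}+\mu_{h-2}=1,\sum_{i=0}^{h-3}\mu_i=c\}$, $S_{E,c}=\{(\mu,\lambda^2,1)\mid \mu_{h-1}=0,\sum_{i=0}^{h-2}\mu_i=c\}$, and $\mathcal{A}_c=S_A\cup S_B\cup S_{C,c}\cup S_{D,c}\cup S_{E,c}$, which is a KM-arc of type $q/4$ in $\mathrm{PG}(2,q)$. Then $\mathcal{A}_c$ is a translation KM-arc.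
   Context: Points of $\mathrm{PG}(2,q)$ are given by homogeneous coordinates $(X,Y,Z)$. A KM-arc of type $t$ in $\mathrm{PG}(2,q)$ is a set of $q+t$ points such that every line meets it in $0$, $2$ or $t$ points, each value occurring. A point set $S$ is a translation set with respect to a line $\ell$ if the group of elations with axis $\ell$ fixing $S$ acts transitively on $S\setminus\ell$; a translation KM-arc is a KM-arc that is a translation set with respect to some line. (That $\mathcal{A}_c$ is a KM-arc of type $q/4$ is due to Vandendriessche.) -}

module Defs where

open import Data.Bool using (Bool; true; false; _xor_; if_then_else_)
open import Data.Nat using (ℕ; zero; suc; _+_; _∸_; _^_; _<_)
open import Data.Vec using (Vec; []; _∷_; zipWith; replicate; toList)
open import Data.List as L using (List; length)
open import Data.List.Relation.Unary.All using (All)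
open import Data.List.Relation.Unary.Any using (Any)
open import Data.List.Relation.Unary.AllPairs using (AllPairs)
open import Data.Product using (Σ; ∃; _×_; _,_)
open import Data.Sum using (_⊎_)
open import Relation.Nullary using (¬_)
open import Relation.Binary.PropositionalEquality using (_≡_; _≢_)

-- Arithmetic of F_q = F_2[x]/(m(x)), q = 2^h, where
--   m(x) = x^h + c_{h-1} x^{h-1} + ... + c_1 x + c_0 .
-- An element μ is stored as its coordinate vector (μ_0,…,μ_{h-1})
-- with respect to the basis 1, λ, …, λ^{h-1}, where λ = x mod m.

-- the i-th coordinate μ_i (false when i ≥ h)
coord : ∀ {h} → Vec Bool h → ℕ → Bool
coord []       _       = false
coord (a ∷ _)  zero    = a
coord (_ ∷ as) (suc i) = coord as i

basis : (h i : ℕ) → Vec Bool h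
basis zero    _       = []
basis (suc h) zero    = true ∷ replicate h false
basis (suc h) (suc i) = false ∷ basis h i

parity : List Bool → Bool
parity = L.foldr _xor_ false

sumUpTo : ∀ {h} → Vec Bool h → ℕ → Bool
sumUpTo μ j = parity (L.take (suc j) (toList μ))

shiftUp : ∀ {h} → Bool → Vec Bool h → Vec Bool h × Bool
shiftUp b []       = [] , b
shiftUp b (a ∷ as) with shiftUp a as
... | r , t = (b ∷ r) , t

module Field {h : ℕ} (c : Vec Bool h) where

  F : Set
  F = Vec Bool h

  _⊕_ : F → F → F
  _⊕_ = zipWith _xor_

  0F : F
  0F = replicate h false

  1F : F
  1F = basis h 0

  λF : F
  λF = basis h 1

  -- multiplication by λ, using λ^h = c_0 + c_1 λ + … + c_{h-1} λ^{h-1}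
  mulλ : F → F
  mulλ a with shiftUp false a
  ... | r , t = r ⊕ (if t then c else 0F)

  mulV : ∀ {n} → F → Vec Bool n → F
  mulV a []       = 0F
  mulV a (b ∷ bs) = (if b then a else 0F) ⊕ mulλ (mulV a bs)

  _*F_ : F → F → F
  a *F b = mulV a b

  _^F_ : F → ℕ → F
  a ^F zero    = 1F
  a ^F (suc n) = a *F (a ^F n)

  -- λ has multiplicative order exactly q - 1 = 2^h - 1.
  -- (This forces F_2[x]/(m) to be the field F_q, m to be irreducible,
  --  hence m is the minimal polynomial of the primitive element λ.)
  IsPrimitive : Set
  IsPrimitive = (λF ^F (2 ^ h ∸ 1) ≡ 1F)
              × (∀ j → 0 < j → j < 2 ^ h ∸ 1 → λF ^F j ≢ 1F)

  -- PG(2,q): vectors of F^3; points are nonzero vectors up to scalars.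

  V : Set
  V = F × F × F

  0V : V
  0V = 0F , 0F , 0F

  Nz : V → Set
  Nz x = x ≢ 0V

  scale : F → V → V
  scale t (a , b , d) = (t *F a) , (t *F b) , (t *F d)

  _+V_ : V → V → V
  (a , b , d) +V (a' , b' , d') = (a ⊕ a') , (b ⊕ b') , (d ⊕ d')

  -- u · x  (u = coordinates of a line, x = coordinates of a point)
  dot : V → V → F
  dot (a , b , d) (a' , b' , d') = ((a *F a') ⊕ (b *F b')) ⊕ (d *F d')

  _∼_ : V → V → Set
  x ∼ y = Σ F λ t → t ≢ 0F × scale t x ≡ y

  OnLine : V → V → Set
  OnLine u x = dot u x ≡ 0F

  HasSize : (V → Set) → ℕ → Set
  HasSize S n = Σ (List V) λ L →
      (length L ≡ n)
    × All (λ x → Nz x × S x) L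
    × AllPairs (λ x y → ¬ (x ∼ y)) L
    × (∀ x → Nz x → S x → Any (x ∼_) L)

  Meets : (V → Set) → V → ℕ → Set
  Meets S u n = HasSize (λ x → S x × OnLine u x) n

  IsKMArc : ℕ → (V → Set) → Set
  IsKMArc t S =
      HasSize S (2 ^ h + t)
    × (∀ u → Nz u → ∀ n → Meets S u n → (n ≡ 0) ⊎ (n ≡ 2) ⊎ (n ≡ t))
    × (∃ λ u → Nz u × Meets S u 0)
    × (∃ λ u → Nz u × Meets S u 2)
    × (∃ λ u → Nz u × Meets S u t)

  -- The elations with axis u (u nonzero) are exactly the maps
  --   x ↦ x + (u·x) v   with u·v = 0   (v = 0 gives the identity).
  elation : V → V → V → V
  elation u v x = x +V scale (dot u x) v

  -- g fixes S (setwise); g is an involution here, so this is g(S) = S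
  Fixes : (V → V) → (V → Set) → Set
  Fixes g S = ∀ z → Nz z → (S z → S (g z)) × (S (g z) → S z)

  IsTranslationSetWrt : V → (V → Set) → Set
  IsTranslationSetWrt u S =
    ∀ x y → Nz x → Nz y → S x → S y → ¬ OnLine u x → ¬ OnLine u y →
    Σ V λ v → OnLine u v × Fixes (elation u v) S × (elation u v x ∼ y)

  IsTranslationSet : (V → Set) → Set
  IsTranslationSet S = Σ V λ u → Nz u × IsTranslationSetWrt u S

  IsTranslationKMArc : (V → Set) → Set
  IsTranslationKMArc S = (∃ λ t → IsKMArc t S) × IsTranslationSet S

  -- The arc A_c  (cc ∈ F_2 is the parameter c of the paper)

  λ² : F
  λ² = λF *F λF

  SA : V → Set
  SA x = Σ F λ μ → (coord μ (h ∸ 2) ≡ false) × (coord μ (h ∸ 3) ≡ true)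
                 × (x ∼ (μ , 1F , 0F))

  SB : V → Set
  SB x = Σ F λ μ → (coord μ (h ∸ 1) ≡ false) × (coord μ (h ∸ 2) ≡ true)
                 × (x ∼ (μ , 0F , 1F))

  SC : Bool → V → Set
  SC cc x = Σ F λ μ → (coord μ (h ∸ 2) ≡ false) × (sumUpTo μ (h ∸ 3) ≡ cc)
                    × (x ∼ (μ , 1F , 1F))

  SD : Bool → V → Set
  SD cc x = Σ F λ μ → ((coord μ (h ∸ 1) xor coord μ (h ∸ 2)) ≡ true)
                    × (sumUpTo μ (h ∸ 3) ≡ cc)
                    × (x ∼ (μ , λF , 1F))

  SE : Bool → V → Set
  SE cc x = Σ F λ μ → (coord μ (h ∸ 1) ≡ false) × (sumUpTo μ (h ∸ 2) ≡ cc)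
                    × (x ∼ (μ , λ² , 1F))

  Arc : Bool → V → Set
  Arc cc x = SA x ⊎ SB x ⊎ SC cc x ⊎ SD cc x ⊎ SE cc x

module Submission where

-- Idea.  Put ρ = 1 + λ and δ = λρ.  The line u contains S_D; every other point
-- of A_c has a representative w = (x, y, z) with u·w = δ, and these "normal
-- vectors" are exactly the vectors with
--   z = α + βλ,   y = δ + λz,   x_{h-1} = 1 + α + β,   Σ_i x_i = (α + β)c
-- for bits α, β; the types (α, β) = (0,0), (1,1), (0,1), (1,0) are the points
-- of S_A, S_B, S_C, S_E scaled by δ, ρ, λ, 1.  (This uses c_{h-1} = c_{h-2} = 0
-- and Σ c_i = 0, which say how multiplication by λ moves μ_{h-2}, μ_{h-3} and
-- the parity.)  The conditions are F_2-affine, so in characteristic two a sum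
-- of three normal vectors is normal.  For normal w₁, w₂ the centre
-- v = δ⁻¹(w₁ + w₂) lies on u, and the elation x ↦ x + (u·x)v fixes u pointwise
-- and maps each normal w to w + w₁ + w₂; so it fixes A_c and maps w₁ to w₂.

open import Defs
open import Algebra.Bundles using (CommutativeSemigroup; CommutativeRing)
import Algebra.Properties.CommutativeSemigroup as CommutativeSemigroupProperties
open import Data.Bool using (Bool; true; false; _xor_; _∧_; not; if_then_else_)
open import Data.Bool.Properties
  using (xor-assoc; xor-comm; xor-same; xor-identityˡ; xor-identityʳ; xor-annihilates-not;
         not-distribˡ-xor; ∧-distribʳ-xor; ∧-zeroʳ; ∧-identityʳ; xor-∧-commutativeRing)
  renaming (_≟_ to _≟ᵇ_)
open import Data.Empty using (⊥-elim)
open import Data.Fin as Fin using (Fin; toℕ)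
open import Data.Fin.Properties using (2↔Bool; toℕ<n; pigeonhole; any?)
open import Data.List using (take)
open import Data.Nat using (ℕ; zero; suc; _+_; _∸_; _^_; _<_; _≤_; z≤n; s≤s)
open import Data.Nat.Properties
  using (m∸n+n≡m; m^n>0; <⇒≤; +-comm; m<n⇒0<n∸m; +-monoʳ-<; m≤m+n; ≤-trans; n≤1+n; _<?_; ≮⇒≥; ≤-refl)
open import Data.Product using (Σ; _×_; _,_; proj₁; proj₂)
open import Data.Sum using (_⊎_; inj₁; inj₂)
open import Data.Vec using (Vec; []; _∷_; zipWith; replicate; toList)
open import Data.Vec.Properties using (zipWith-comm; zipWith-assoc; zipWith-identityˡ; zipWith-identityʳ; ≡-dec)
open import Data.Vec.Recursive using (lift↔; Fin[m^n]↔Fin[m]^n)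
open import Data.Vec.Recursive.Properties using (↔Vec)
open import Function.Base using (_∘_)
open import Function.Bundles using (Injection; _↣_)
open import Function.Properties.Inverse using (↔-trans; ↔-sym; ↔⇒↣)
open import Level using (0ℓ)
open import Relation.Nullary using (yes; no; ¬_)
open import Relation.Binary.PropositionalEquality
open ≡-Reasoning

xor-interchange : ∀ a b d e → (a xor b) xor (d xor e) ≡ (a xor d) xor (b xor e)
xor-interchange = CommutativeSemigroupProperties.interchange
  (CommutativeRing.+-commutativeSemigroup xor-∧-commutativeRing)

xor-cancelʳ : ∀ a b → (a xor b) xor b ≡ a
xor-cancelʳ a b = trans (xor-assoc a b b) (trans (cong (a xor_) (xor-same b)) (xor-identityʳ a))

xor-cancelˡ : ∀ a b → a xor (a xor b) ≡ b
xor-cancelˡ a b = trans (sym (xor-assoc a a b)) (cong (_xor b) (xor-same a))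

xor-solveʳ : ∀ {a t p} → a xor t ≡ p → a ≡ p xor t
xor-solveʳ {a} {t} refl = sym (xor-cancelʳ a t)

-- not x = 1 + x is affine, and 1 + 1 + 1 = 1: a sum of three values of an
-- affine map is the value at the sum
not-sum3 : ∀ a b d → not a xor (not b xor not d) ≡ not (a xor (b xor d))
not-sum3 a b d = trans (cong (not a xor_) (xor-annihilates-not b d)) (sym (not-distribˡ-xor a (b xor d)))

infixl 6 _⊕_
infixr 7 _·_

_⊕_ : ∀ {n} → Vec Bool n → Vec Bool n → Vec Bool n
_⊕_ = zipWith _xor_

𝟎 : ∀ n → Vec Bool n
𝟎 n = replicate n false

_·_ : ∀ {n} → Bool → Vec Bool n → Vec Bool n
t · a = if t then a else 𝟎 _

⊕-comm : ∀ {n} (a b : Vec Bool n) → a ⊕ b ≡ b ⊕ a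
⊕-comm = zipWith-comm xor-comm

⊕-assoc : ∀ {n} (a b d : Vec Bool n) → (a ⊕ b) ⊕ d ≡ a ⊕ (b ⊕ d)
⊕-assoc = zipWith-assoc xor-assoc

⊕-identityˡ : ∀ {n} (a : Vec Bool n) → 𝟎 n ⊕ a ≡ a
⊕-identityˡ = zipWith-identityˡ xor-identityˡ

⊕-identityʳ : ∀ {n} (a : Vec Bool n) → a ⊕ 𝟎 n ≡ a
⊕-identityʳ = zipWith-identityʳ xor-identityʳ

⊕-self : ∀ {n} (a : Vec Bool n) → a ⊕ a ≡ 𝟎 n
⊕-self []      = refl
⊕-self (x ∷ a) = cong₂ _∷_ (xor-same x) (⊕-self a)

-- packaged as a bundle, to import the rearrangement laws of the library
⊕-commutativeSemigroup : ℕ → CommutativeSemigroup 0ℓ 0ℓ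
⊕-commutativeSemigroup n = record
  { Carrier = Vec Bool n
  ; _≈_     = _≡_
  ; _∙_     = _⊕_
  ; isCommutativeSemigroup = record
    { isSemigroup = record
      { isMagma = record { isEquivalence = isEquivalence ; ∙-cong = cong₂ _⊕_ }
      ; assoc   = ⊕-assoc }
    ; comm = ⊕-comm } }

⊕-interchange : ∀ {n} (a b d e : Vec Bool n) → (a ⊕ b) ⊕ (d ⊕ e) ≡ (a ⊕ d) ⊕ (b ⊕ e)
⊕-interchange {n} = CommutativeSemigroupProperties.interchange (⊕-commutativeSemigroup n)

⊕-cancelˡ : ∀ {n} (a b : Vec Bool n) → a ⊕ (a ⊕ b) ≡ b
⊕-cancelˡ {n} a b = begin
  a ⊕ (a ⊕ b) ≡⟨ ⊕-assoc a a b ⟨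
  (a ⊕ a) ⊕ b ≡⟨ cong (_⊕ b) (⊕-self a) ⟩
  𝟎 n ⊕ b     ≡⟨ ⊕-identityˡ b ⟩
  b           ∎

⊕-cancelʳ : ∀ {n} (a b : Vec Bool n) → (a ⊕ b) ⊕ b ≡ a
⊕-cancelʳ {n} a b = begin
  (a ⊕ b) ⊕ b ≡⟨ ⊕-assoc a b b ⟩
  a ⊕ (b ⊕ b) ≡⟨ cong (a ⊕_) (⊕-self b) ⟩
  a ⊕ 𝟎 n     ≡⟨ ⊕-identityʳ a ⟩
  a           ∎

-- a sum of three vectors of the affine form d + aᵢ is again of that form,
-- because d + d + d = d in characteristic two
⊕-affine-sum3 : ∀ {n} (d a b e : Vec Bool n) → (d ⊕ a) ⊕ ((d ⊕ b) ⊕ (d ⊕ e)) ≡ d ⊕ (a ⊕ (b ⊕ e))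
⊕-affine-sum3 {n} d a b e = begin
  (d ⊕ a) ⊕ ((d ⊕ b) ⊕ (d ⊕ e)) ≡⟨ cong ((d ⊕ a) ⊕_) (⊕-interchange d b d e) ⟩
  (d ⊕ a) ⊕ ((d ⊕ d) ⊕ (b ⊕ e)) ≡⟨ cong (λ s → (d ⊕ a) ⊕ (s ⊕ (b ⊕ e))) (⊕-self d) ⟩
  (d ⊕ a) ⊕ (𝟎 n ⊕ (b ⊕ e))     ≡⟨ cong ((d ⊕ a) ⊕_) (⊕-identityˡ (b ⊕ e)) ⟩
  (d ⊕ a) ⊕ (b ⊕ e)             ≡⟨ ⊕-assoc d a (b ⊕ e) ⟩
  d ⊕ (a ⊕ (b ⊕ e))             ∎

·-distrib-xor : ∀ {n} s t (a : Vec Bool n) → (s xor t) · a ≡ s · a ⊕ t · a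
·-distrib-xor false false a = sym (⊕-identityʳ _)
·-distrib-xor false true  a = sym (⊕-identityˡ a)
·-distrib-xor true  false a = sym (⊕-identityʳ a)
·-distrib-xor true  true  a = sym (⊕-self a)

·-𝟎 : ∀ {n} t → t · 𝟎 n ≡ 𝟎 n
·-𝟎 false = refl
·-𝟎 true  = refl

·-distrib-⊕ : ∀ {n} t (a b : Vec Bool n) → t · (a ⊕ b) ≡ t · a ⊕ t · b
·-distrib-⊕ false a b = sym (⊕-identityʳ _)
·-distrib-⊕ true  a b = refl

coord-⊕ : ∀ {n} (a b : Vec Bool n) i → coord (a ⊕ b) i ≡ coord a i xor coord b i
coord-⊕ []      []      i       = refl
coord-⊕ (x ∷ a) (y ∷ b) zero    = refl
coord-⊕ (x ∷ a) (y ∷ b) (suc i) = coord-⊕ a b i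

coord-𝟎 : ∀ n i → coord (𝟎 n) i ≡ false
coord-𝟎 zero    i       = refl
coord-𝟎 (suc n) zero    = refl
coord-𝟎 (suc n) (suc i) = coord-𝟎 n i

coord-· : ∀ {n} t (a : Vec Bool n) i → coord (t · a) i ≡ t ∧ coord a i
coord-· {n} false a i = coord-𝟎 n i
coord-· true  a i = refl

coord-beyond : ∀ {n} (v : Vec Bool n) i → n ≤ i → coord v i ≡ false
coord-beyond []      i       _       = refl
coord-beyond (x ∷ v) (suc i) (s≤s p) = coord-beyond v i p

coord-ext : ∀ {n} (a b : Vec Bool n) → (∀ i → coord a i ≡ coord b i) → a ≡ b
coord-ext []      []      _  = refl
coord-ext (x ∷ a) (y ∷ b) eq = cong₂ _∷_ (eq zero) (coord-ext a b (λ i → eq (suc i)))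

par : ∀ {n} → Vec Bool n → Bool
par v = parity (toList v)

par-⊕ : ∀ {n} (a b : Vec Bool n) → par (a ⊕ b) ≡ par a xor par b
par-⊕ []      []      = refl
par-⊕ (x ∷ a) (y ∷ b) = trans (cong ((x xor y) xor_) (par-⊕ a b)) (xor-interchange x y (par a) (par b))

par-𝟎 : ∀ n → par (𝟎 n) ≡ false
par-𝟎 zero    = refl
par-𝟎 (suc n) = par-𝟎 n

par-· : ∀ {n} t (a : Vec Bool n) → par (t · a) ≡ t ∧ par a
par-· {n} false a = par-𝟎 n
par-· true  a = refl

sumUpTo-last : ∀ {n} (v : Vec Bool (suc n)) → parity (take n (toList v)) xor coord v n ≡ par v
sumUpTo-last (x ∷ [])    = sym (xor-identityʳ x)
sumUpTo-last (x ∷ y ∷ v) = trans (xor-assoc x _ _) (cong (x xor_) (sumUpTo-last (y ∷ v)))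

sumUpTo-last2 : ∀ {n} (v : Vec Bool (suc (suc n))) →
  (parity (take n (toList v)) xor coord v n) xor coord v (suc n) ≡ par v
sumUpTo-last2 (x ∷ y ∷ [])    = cong (x xor_) (sym (xor-identityʳ y))
sumUpTo-last2 (x ∷ y ∷ z ∷ v) =
  trans (cong (_xor _) (xor-assoc x _ _)) (trans (xor-assoc x _ _) (cong (x xor_) (sumUpTo-last2 (y ∷ z ∷ v))))

shiftUp-⊕ : ∀ {n} s t (a b : Vec Bool n) →
  shiftUp (s xor t) (a ⊕ b)
    ≡ (proj₁ (shiftUp s a) ⊕ proj₁ (shiftUp t b) , proj₂ (shiftUp s a) xor proj₂ (shiftUp t b))
shiftUp-⊕ s t []      []      = refl
shiftUp-⊕ s t (x ∷ a) (y ∷ b) rewrite shiftUp-⊕ x y a b = refl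

shiftUp-𝟎 : ∀ n → shiftUp false (𝟎 n) ≡ (𝟎 n , false)
shiftUp-𝟎 zero    = refl
shiftUp-𝟎 (suc n) rewrite shiftUp-𝟎 n = refl

shiftUp-carry : ∀ {n} b (a : Vec Bool (suc n)) → proj₂ (shiftUp b a) ≡ coord a n
shiftUp-carry b (x ∷ [])    = refl
shiftUp-carry b (x ∷ y ∷ a) = shiftUp-carry x (y ∷ a)

shiftUp-coord0 : ∀ {n} b (a : Vec Bool (suc n)) → coord (proj₁ (shiftUp b a)) zero ≡ b
shiftUp-coord0 b (x ∷ a) = refl

shiftUp-coordSuc : ∀ {n} b (a : Vec Bool (suc n)) i → i < n → coord (proj₁ (shiftUp b a)) (suc i) ≡ coord a i
shiftUp-coordSuc b (x ∷ y ∷ a) zero    _       = refl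
shiftUp-coordSuc b (x ∷ y ∷ a) (suc i) (s≤s p) = shiftUp-coordSuc x (y ∷ a) i p

shiftUp-par : ∀ {n} b (a : Vec Bool n) → par (proj₁ (shiftUp b a)) xor proj₂ (shiftUp b a) ≡ b xor par a
shiftUp-par b []      = sym (xor-identityʳ b)
shiftUp-par b (x ∷ a) = trans (xor-assoc b _ _) (cong (b xor_) (shiftUp-par x a))

bits↣Fin : ∀ n → Vec Bool n ↣ Fin (2 ^ n)
bits↣Fin n = ↔⇒↣ (↔-sym (↔-trans (Fin[m^n]↔Fin[m]^n 2 n) (↔-trans (lift↔ n 2↔Bool) (↔Vec n))))

module RingLaws {n : ℕ} (c : Vec Bool (suc (suc n))) where
  open Field c hiding (_⊕_)

  -- index h - 1 of the top coordinate
  top : ℕ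
  top = suc n

  mulλ-⊕ : ∀ a b → mulλ (a ⊕ b) ≡ mulλ a ⊕ mulλ b
  mulλ-⊕ a b = begin
      mulλ (a ⊕ b)
    ≡⟨ cong (λ p → proj₁ p ⊕ proj₂ p · c) (shiftUp-⊕ false false a b) ⟩
      (ra ⊕ rb) ⊕ (ta xor tb) · c
    ≡⟨ cong ((ra ⊕ rb) ⊕_) (·-distrib-xor ta tb c) ⟩
      (ra ⊕ rb) ⊕ (ta · c ⊕ tb · c)
    ≡⟨ ⊕-interchange ra rb _ _ ⟩
      mulλ a ⊕ mulλ b ∎
    where
    ra = proj₁ (shiftUp false a)
    rb = proj₁ (shiftUp false b)
    ta = proj₂ (shiftUp false a)
    tb = proj₂ (shiftUp false b)

  mulλ-𝟎 : mulλ 0F ≡ 0F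
  mulλ-𝟎 rewrite shiftUp-𝟎 n = ⊕-identityʳ _

  mulλ-· : ∀ t a → mulλ (t · a) ≡ t · mulλ a
  mulλ-· false a = mulλ-𝟎
  mulλ-· true  a = refl

  -- λ · Σ y_i λ^i = Σ y_i λ^{i+1}, and λ^h = Σ c_i λ^i
  mulλ-coord0 : ∀ y → coord (mulλ y) zero ≡ coord y top ∧ coord c zero
  mulλ-coord0 y
    rewrite coord-⊕ (proj₁ (shiftUp false y)) (proj₂ (shiftUp false y) · c) zero
          | shiftUp-coord0 false y | coord-· (proj₂ (shiftUp false y)) c zero | shiftUp-carry false y = refl

  mulλ-coordSuc : ∀ y i → i < top → coord (mulλ y) (suc i) ≡ coord y i xor (coord y top ∧ coord c (suc i))
  mulλ-coordSuc y i i<top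
    rewrite coord-⊕ (proj₁ (shiftUp false y)) (proj₂ (shiftUp false y) · c) (suc i)
          | shiftUp-coordSuc false y i i<top | coord-· (proj₂ (shiftUp false y)) c (suc i)
          | shiftUp-carry false y = refl

  mulλ-par : ∀ y → par (mulλ y) ≡ (par y xor coord y top) xor (coord y top ∧ par c)
  mulλ-par y = begin
      par (mulλ y)
    ≡⟨ par-⊕ r (t · c) ⟩
      par r xor par (t · c)
    ≡⟨ cong (par r xor_) (par-· t c) ⟩
      par r xor (t ∧ par c)
    ≡⟨ cong (_xor (t ∧ par c)) (xor-solveʳ {par r} {t} (shiftUp-par false y)) ⟩
      (par y xor t) xor (t ∧ par c)
    ≡⟨ cong (λ s → (par y xor s) xor (s ∧ par c)) (shiftUp-carry false y) ⟩
      (par y xor coord y top) xor (coord y top ∧ par c) ∎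
    where
    r = proj₁ (shiftUp false y)
    t = proj₂ (shiftUp false y)

  mulV-zeroˡ : ∀ {k} (bs : Vec Bool k) → mulV 0F bs ≡ 0F
  mulV-zeroˡ []       = refl
  mulV-zeroˡ (b ∷ bs) rewrite mulV-zeroˡ bs | mulλ-𝟎 | ·-𝟎 {suc (suc n)} b = ⊕-identityʳ _

  mulV-zeroʳ : ∀ k a → mulV a (𝟎 k) ≡ 0F
  mulV-zeroʳ zero    a = refl
  mulV-zeroʳ (suc k) a rewrite mulV-zeroʳ k a | mulλ-𝟎 = ⊕-identityʳ _

  mulV-⊕ˡ : ∀ {k} a a' (bs : Vec Bool k) → mulV (a ⊕ a') bs ≡ mulV a bs ⊕ mulV a' bs
  mulV-⊕ˡ a a' []       = sym (⊕-identityʳ _)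
  mulV-⊕ˡ a a' (b ∷ bs)
    rewrite mulV-⊕ˡ a a' bs | mulλ-⊕ (mulV a bs) (mulV a' bs) | ·-distrib-⊕ b a a' =
    ⊕-interchange (b · a) (b · a') (mulλ (mulV a bs)) (mulλ (mulV a' bs))

  mulV-⊕ʳ : ∀ {k} a (b b' : Vec Bool k) → mulV a (b ⊕ b') ≡ mulV a b ⊕ mulV a b'
  mulV-⊕ʳ a []      []        = sym (⊕-identityʳ _)
  mulV-⊕ʳ a (x ∷ b) (y ∷ b')
    rewrite mulV-⊕ʳ a b b' | mulλ-⊕ (mulV a b) (mulV a b') | ·-distrib-xor x y a =
    ⊕-interchange (x · a) (y · a) (mulλ (mulV a b)) (mulλ (mulV a b'))

  mulV-mulλ : ∀ {k} a (bs : Vec Bool k) → mulV (mulλ a) bs ≡ mulλ (mulV a bs)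
  mulV-mulλ a []       = sym mulλ-𝟎
  mulV-mulλ a (b ∷ bs) rewrite mulV-mulλ a bs | mulλ-⊕ (b · a) (mulλ (mulV a bs)) | mulλ-· b a = refl

  mulV-· : ∀ {k} t a (bs : Vec Bool k) → mulV (t · a) bs ≡ t · mulV a bs
  mulV-· false a bs = mulV-zeroˡ bs
  mulV-· true  a bs = refl

  mulV-swap : ∀ {k l} x (b : Vec Bool k) (b' : Vec Bool l) → mulV (mulV x b') b ≡ mulV (mulV x b) b'
  mulV-swap x []        b' = sym (mulV-zeroˡ b')
  mulV-swap x (b₀ ∷ bs) b'
    rewrite mulV-⊕ˡ (b₀ · x) (mulλ (mulV x bs)) b' | mulV-· b₀ x b' | mulV-mulλ (mulV x bs) b'
          | mulV-swap x bs b' = refl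

  mulV-one-coord : ∀ {k} (bs : Vec Bool k) → k ≤ suc top → ∀ i → coord (mulV 1F bs) i ≡ coord bs i
  mulV-one-coord []       _       i = coord-𝟎 (suc top) i
  mulV-one-coord (b ∷ bs) (s≤s p) zero
    rewrite coord-⊕ (b · 1F) (mulλ (mulV 1F bs)) zero
          | coord-· b 1F zero | mulλ-coord0 (mulV 1F bs) | mulV-one-coord bs (≤-trans p (n≤1+n _)) top
          | coord-beyond bs top p | ∧-identityʳ b = xor-identityʳ b
  mulV-one-coord (b ∷ bs) (s≤s p) (suc j)
    rewrite coord-⊕ (b · 1F) (mulλ (mulV 1F bs)) (suc j)
          | coord-· b 1F (suc j) | coord-𝟎 top j | ∧-zeroʳ b with j <? top
  ... | yes j<top rewrite mulλ-coordSuc (mulV 1F bs) j j<top | mulV-one-coord bs (≤-trans p (n≤1+n _)) top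
          | coord-beyond bs top p | mulV-one-coord bs (≤-trans p (n≤1+n _)) j = xor-identityʳ _
  ... | no j≮top = trans (coord-beyond (mulλ (mulV 1F bs)) (suc j) (s≤s (≮⇒≥ j≮top)))
                         (sym (coord-beyond bs j (≤-trans p (≮⇒≥ j≮top))))

  *-identityˡ : ∀ a → 1F *F a ≡ a
  *-identityˡ a = coord-ext _ _ (mulV-one-coord a ≤-refl)

  *-identityʳ : ∀ a → a *F 1F ≡ a
  *-identityʳ a rewrite mulV-zeroʳ top a | mulλ-𝟎 = ⊕-identityʳ a

  *-zeroˡ : ∀ a → 0F *F a ≡ 0F
  *-zeroˡ = mulV-zeroˡ

  *-zeroʳ : ∀ a → a *F 0F ≡ 0F
  *-zeroʳ a = mulV-zeroʳ (suc top) a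

  *-distribˡ : ∀ a b d → a *F (b ⊕ d) ≡ (a *F b) ⊕ (a *F d)
  *-distribˡ = mulV-⊕ʳ

  *-distribʳ : ∀ a b d → (a ⊕ b) *F d ≡ (a *F d) ⊕ (b *F d)
  *-distribʳ = mulV-⊕ˡ

  *-comm : ∀ a b → a *F b ≡ b *F a
  *-comm a b = begin
      mulV a b          ≡⟨ cong (λ z → mulV z b) (*-identityˡ a) ⟨
      mulV (mulV 1F a) b ≡⟨ mulV-swap 1F b a ⟩
      mulV (mulV 1F b) a ≡⟨ cong (λ z → mulV z a) (*-identityˡ b) ⟩
      mulV b a          ∎

  *-assoc : ∀ a b d → (a *F b) *F d ≡ a *F (b *F d)
  *-assoc a b d = begin
      (a *F b) *F d ≡⟨ cong (_*F d) (*-comm a b) ⟩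
      (b *F a) *F d ≡⟨ mulV-swap b d a ⟩
      (b *F d) *F a ≡⟨ *-comm (b *F d) a ⟩
      a *F (b *F d) ∎

  *-swap : ∀ a b d → a *F (b *F d) ≡ b *F (a *F d)
  *-swap a b d = begin
      a *F (b *F d) ≡⟨ *-assoc a b d ⟨
      (a *F b) *F d ≡⟨ cong (_*F d) (*-comm a b) ⟩
      (b *F a) *F d ≡⟨ *-assoc b a d ⟩
      b *F (a *F d) ∎

  λ*≡mulλ : ∀ a → λF *F a ≡ mulλ a
  λ*≡mulλ a = begin
      λF *F a          ≡⟨ cong (_*F a) λ≡mulλ1 ⟩
      mulV (mulλ 1F) a ≡⟨ mulV-mulλ 1F a ⟩
      mulλ (1F *F a)   ≡⟨ cong mulλ (*-identityˡ a) ⟩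
      mulλ a           ∎
    where
    λ≡mulλ1 : λF ≡ mulλ 1F
    λ≡mulλ1 rewrite shiftUp-𝟎 n = sym (⊕-identityʳ _)

  ^-+ : ∀ a i j → a ^F (i + j) ≡ (a ^F i) *F (a ^F j)
  ^-+ a zero    j = sym (*-identityˡ (a ^F j))
  ^-+ a (suc i) j = trans (cong (a *F_) (^-+ a i j)) (sym (*-assoc a (a ^F i) (a ^F j)))

  1≢0 : 1F ≢ 0F
  1≢0 ()

  λ≢0 : λF ≢ 0F
  λ≢0 ()

  scale-∘ : ∀ s t (x : V) → scale s (scale t x) ≡ scale (s *F t) x
  scale-∘ s t (a , b , d) =
    cong₂ _,_ (sym (*-assoc s t a)) (cong₂ _,_ (sym (*-assoc s t b)) (sym (*-assoc s t d)))

  scale-one : ∀ (x : V) → scale 1F x ≡ x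
  scale-one (a , b , d) = cong₂ _,_ (*-identityˡ a) (cong₂ _,_ (*-identityˡ b) (*-identityˡ d))

  dot-scale : ∀ (w : V) t (x : V) → dot w (scale t x) ≡ t *F dot w x
  dot-scale (w₁ , w₂ , w₃) t (a , b , d) = begin
      ((w₁ *F (t *F a)) ⊕ (w₂ *F (t *F b))) ⊕ (w₃ *F (t *F d))
    ≡⟨ cong₂ _⊕_ (cong₂ _⊕_ (*-swap w₁ t a) (*-swap w₂ t b)) (*-swap w₃ t d) ⟩
      ((t *F (w₁ *F a)) ⊕ (t *F (w₂ *F b))) ⊕ (t *F (w₃ *F d))
    ≡⟨ cong (_⊕ (t *F (w₃ *F d))) (*-distribˡ t (w₁ *F a) (w₂ *F b)) ⟨
      (t *F ((w₁ *F a) ⊕ (w₂ *F b))) ⊕ (t *F (w₃ *F d))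
    ≡⟨ *-distribˡ t ((w₁ *F a) ⊕ (w₂ *F b)) (w₃ *F d) ⟨
      t *F (((w₁ *F a) ⊕ (w₂ *F b)) ⊕ (w₃ *F d)) ∎

  dot-+V : ∀ (w x y : V) → dot w (x +V y) ≡ dot w x ⊕ dot w y
  dot-+V (w₁ , w₂ , w₃) (a , b , d) (a' , b' , d') = begin
      ((w₁ *F (a ⊕ a')) ⊕ (w₂ *F (b ⊕ b'))) ⊕ (w₃ *F (d ⊕ d'))
    ≡⟨ cong₂ _⊕_ (cong₂ _⊕_ (*-distribˡ w₁ a a') (*-distribˡ w₂ b b')) (*-distribˡ w₃ d d') ⟩
      (((w₁ *F a) ⊕ (w₁ *F a')) ⊕ ((w₂ *F b) ⊕ (w₂ *F b'))) ⊕ ((w₃ *F d) ⊕ (w₃ *F d'))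
    ≡⟨ cong (_⊕ ((w₃ *F d) ⊕ (w₃ *F d'))) (⊕-interchange (w₁ *F a) (w₁ *F a') _ _) ⟩
      (((w₁ *F a) ⊕ (w₂ *F b)) ⊕ ((w₁ *F a') ⊕ (w₂ *F b'))) ⊕ ((w₃ *F d) ⊕ (w₃ *F d'))
    ≡⟨ ⊕-interchange ((w₁ *F a) ⊕ (w₂ *F b)) _ _ _ ⟩
      (((w₁ *F a) ⊕ (w₂ *F b)) ⊕ (w₃ *F d)) ⊕ (((w₁ *F a') ⊕ (w₂ *F b')) ⊕ (w₃ *F d')) ∎

  elation-scale : ∀ u v t (x : V) → elation u v (scale t x) ≡ scale t (elation u v x)
  elation-scale u (v₁ , v₂ , v₃) t x@(a , b , d) rewrite dot-scale u t x =
    cong₂ _,_ (distrib a v₁) (cong₂ _,_ (distrib b v₂) (distrib d v₃))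
    where
    distrib : ∀ p q → (t *F p) ⊕ ((t *F dot u x) *F q) ≡ t *F (p ⊕ (dot u x *F q))
    distrib p q = trans (cong ((t *F p) ⊕_) (*-assoc t (dot u x) q)) (sym (*-distribˡ t p (dot u x *F q)))

  elation-axis : ∀ u v (x : V) → dot u x ≡ 0F → elation u v x ≡ x
  elation-axis u (v₁ , v₂ , v₃) (a , b , d) ux≡0 rewrite ux≡0 | *-zeroˡ v₁ | *-zeroˡ v₂ | *-zeroˡ v₃ =
    cong₂ _,_ (⊕-identityʳ a) (cong₂ _,_ (⊕-identityʳ b) (⊕-identityʳ d))

  +V-cancelʳ : ∀ (x y : V) → (x +V y) +V y ≡ x
  +V-cancelʳ (a , b , d) (a' , b' , d') = cong₂ _,_ (⊕-cancelʳ a a') (cong₂ _,_ (⊕-cancelʳ b b') (⊕-cancelʳ d d'))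

  +V-cancelˡ : ∀ (x y : V) → x +V (x +V y) ≡ y
  +V-cancelˡ (a , b , d) (a' , b' , d') = cong₂ _,_ (⊕-cancelˡ a a') (cong₂ _,_ (⊕-cancelˡ b b') (⊕-cancelˡ d d'))

  elation-involutive : ∀ u v → dot u v ≡ 0F → ∀ x → elation u v (elation u v x) ≡ x
  elation-involutive u v uv≡0 x = begin
      elation u v (elation u v x)
    ≡⟨ cong (λ s → (x +V scale (dot u x) v) +V scale s v) dot-unchanged ⟩
      (x +V scale (dot u x) v) +V scale (dot u x) v
    ≡⟨ +V-cancelʳ x (scale (dot u x) v) ⟩
      x ∎
    where
    dot-unchanged : dot u (elation u v x) ≡ dot u x
    dot-unchanged = begin
        dot u (x +V scale (dot u x) v)      ≡⟨ dot-+V u x (scale (dot u x) v) ⟩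
        dot u x ⊕ dot u (scale (dot u x) v) ≡⟨ cong (dot u x ⊕_) (dot-scale u (dot u x) v) ⟩
        dot u x ⊕ (dot u x *F dot u v)      ≡⟨ cong (λ s → dot u x ⊕ (dot u x *F s)) uv≡0 ⟩
        dot u x ⊕ (dot u x *F 0F)           ≡⟨ cong (dot u x ⊕_) (*-zeroʳ (dot u x)) ⟩
        dot u x ⊕ 0F                        ≡⟨ ⊕-identityʳ (dot u x) ⟩
        dot u x                             ∎

-- If λ is primitive then every nonzero element is a power of λ, hence
-- invertible: F_2[x]/(m) is the field F_q.

module Inverses {n : ℕ} (c : Vec Bool (suc (suc n))) (prim : Field.IsPrimitive c) where
  open Field c hiding (_⊕_)
  open RingLaws c

  N : ℕ
  N = 2 ^ suc top ∸ 1

  λ^-complement : ∀ j → j ≤ N → (λF ^F (N ∸ j)) *F (λF ^F j) ≡ 1F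
  λ^-complement j j≤N = begin
    (λF ^F (N ∸ j)) *F (λF ^F j) ≡⟨ ^-+ λF (N ∸ j) j ⟨
    λF ^F (N ∸ j + j)            ≡⟨ cong (λF ^F_) (m∸n+n≡m j≤N) ⟩
    λF ^F N                      ≡⟨ proj₁ prim ⟩
    1F                           ∎

  λ^≢0 : ∀ j → j ≤ N → λF ^F j ≢ 0F
  λ^≢0 j j≤N λ^j≡0 = 1≢0 (begin
    1F                             ≡⟨ λ^-complement j j≤N ⟨
    (λF ^F (N ∸ j)) *F (λF ^F j)   ≡⟨ cong ((λF ^F (N ∸ j)) *F_) λ^j≡0 ⟩
    (λF ^F (N ∸ j)) *F 0F          ≡⟨ *-zeroʳ _ ⟩
    0F                             ∎)

  λ^-injective : ∀ i j → i < j → j < N → λF ^F i ≢ λF ^F j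
  λ^-injective i j i<j j<N λ^i≡λ^j = proj₂ prim (N ∸ j + i) 0<d d<N (begin
    λF ^F (N ∸ j + i)            ≡⟨ ^-+ λF (N ∸ j) i ⟩
    (λF ^F (N ∸ j)) *F (λF ^F i) ≡⟨ cong ((λF ^F (N ∸ j)) *F_) λ^i≡λ^j ⟩
    (λF ^F (N ∸ j)) *F (λF ^F j) ≡⟨ λ^-complement j (<⇒≤ j<N) ⟩
    1F                           ∎)
    where
    0<d : 0 < N ∸ j + i
    0<d = ≤-trans (m<n⇒0<n∸m j<N) (m≤m+n _ i)
    d<N : N ∸ j + i < N
    d<N = subst (N ∸ j + i <_) (m∸n+n≡m (<⇒≤ j<N)) (+-monoʳ-< (N ∸ j) i<j)

  candidates : F → Fin (2 + N) → F
  candidates a Fin.zero              = 0F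
  candidates a (Fin.suc Fin.zero)    = a
  candidates a (Fin.suc (Fin.suc i)) = λF ^F toℕ i

  candidates-injective : ∀ a → a ≢ 0F → ¬ (Σ (Fin N) λ i → λF ^F toℕ i ≡ a) →
    ∀ i j → i Fin.< j → candidates a i ≢ candidates a j
  candidates-injective a a≢0 _ Fin.zero (Fin.suc Fin.zero) _ e = a≢0 (sym e)
  candidates-injective a _ _ Fin.zero (Fin.suc (Fin.suc j)) _ e = λ^≢0 (toℕ j) (<⇒≤ (toℕ<n j)) (sym e)
  candidates-injective a _ no-power (Fin.suc Fin.zero) (Fin.suc (Fin.suc j)) _ e = no-power (j , sym e)
  candidates-injective a _ _ (Fin.suc (Fin.suc i)) (Fin.suc (Fin.suc j)) (s≤s (s≤s i<j)) e =
    λ^-injective (toℕ i) (toℕ j) i<j (toℕ<n j) e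
  candidates-injective a _ _ (Fin.suc Fin.zero) (Fin.suc Fin.zero) (s≤s ())

  q<q+1 : 2 ^ suc top < 2 + N
  q<q+1 = subst (_< 2 + N) (trans (+-comm 1 N) (m∸n+n≡m (m^n>0 2 (suc top)))) ≤-refl

  -- pigeonhole: if a ≠ 0 were no power of λ, the q + 1 candidates would be
  -- distinct elements of the q-element set F
  nonzero-is-power : ∀ a → a ≢ 0F → Σ ℕ λ i → i < N × λF ^F i ≡ a
  nonzero-is-power a a≢0 with any? {n = N} (λ i → ≡-dec _≟ᵇ_ (λF ^F toℕ i) a)
  ... | yes (i , λ^i≡a) = toℕ i , toℕ<n i , λ^i≡a
  ... | no  no-power
    with i , j , i<j , same-code ← pigeonhole q<q+1 (Injection.to (bits↣Fin (suc top)) ∘ candidates a)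
    = ⊥-elim (candidates-injective a a≢0 no-power i j i<j (Injection.injective (bits↣Fin (suc top)) same-code))

  inverse : ∀ a → a ≢ 0F → Σ F λ b → b *F a ≡ 1F
  inverse a a≢0 with nonzero-is-power a a≢0
  ... | i , i<N , refl = λF ^F (N ∸ i) , λ^-complement i (<⇒≤ i<N)

  infix 25 _⁻¹⟨_⟩
  _⁻¹⟨_⟩ : (a : F) → a ≢ 0F → F
  a ⁻¹⟨ a≢0 ⟩ = proj₁ (inverse a a≢0)

  inverseˡ : ∀ a (a≢0 : a ≢ 0F) → a ⁻¹⟨ a≢0 ⟩ *F a ≡ 1F
  inverseˡ a a≢0 = proj₂ (inverse a a≢0)

  inverseʳ : ∀ a (a≢0 : a ≢ 0F) → a *F a ⁻¹⟨ a≢0 ⟩ ≡ 1F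
  inverseʳ a a≢0 = trans (*-comm a _) (inverseˡ a a≢0)

  inverse-cancel : ∀ a (a≢0 : a ≢ 0F) x → a ⁻¹⟨ a≢0 ⟩ *F (a *F x) ≡ x
  inverse-cancel a a≢0 x = begin
    a ⁻¹⟨ a≢0 ⟩ *F (a *F x) ≡⟨ *-assoc _ a x ⟨
    (a ⁻¹⟨ a≢0 ⟩ *F a) *F x ≡⟨ cong (_*F x) (inverseˡ a a≢0) ⟩
    1F *F x                 ≡⟨ *-identityˡ x ⟩
    x                       ∎

  inverse-cancelʳ : ∀ a (a≢0 : a ≢ 0F) x → a *F (a ⁻¹⟨ a≢0 ⟩ *F x) ≡ x
  inverse-cancelʳ a a≢0 x = trans (*-swap a _ x) (inverse-cancel a a≢0 x)

  inverse≢0 : ∀ a (a≢0 : a ≢ 0F) → a ⁻¹⟨ a≢0 ⟩ ≢ 0F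
  inverse≢0 a a≢0 a⁻¹≡0 = 1≢0 (trans (sym (inverseˡ a a≢0)) (trans (cong (_*F a) a⁻¹≡0) (*-zeroˡ a)))

  *-cancel-zero : ∀ t a → t ≢ 0F → t *F a ≡ 0F → a ≡ 0F
  *-cancel-zero t a t≢0 ta≡0 = trans (sym (inverse-cancel t t≢0 a)) (trans (cong (_ *F_) ta≡0) (*-zeroʳ _))

  *-nonzero : ∀ a b → a ≢ 0F → b ≢ 0F → a *F b ≢ 0F
  *-nonzero a b a≢0 b≢0 ab≡0 = b≢0 (*-cancel-zero a b a≢0 ab≡0)

-- The arc A_c for h = k + 3, with c_{h-1} = c_{h-2} = 0 and λ primitive.
-- Indices: top = h - 1, suc k = h - 2, k = h - 3.

module TranslationArc {k : ℕ} (c : Vec Bool (suc (suc (suc k))))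
    (c-top : coord c (suc (suc k)) ≡ false) (c-sub : coord c (suc k) ≡ false)
    (prim : Field.IsPrimitive c) (cc : Bool) where
  open Field c hiding (_⊕_)
  open RingLaws c
  open Inverses c prim

  ρ : F
  ρ = 1F ⊕ λF

  ρ≢0 : ρ ≢ 0F
  ρ≢0 ()

  ρ*≡ : ∀ y → ρ *F y ≡ y ⊕ mulλ y
  ρ*≡ y = trans (*-distribʳ 1F λF y) (cong₂ _⊕_ (*-identityˡ y) (λ*≡mulλ y))

  -- m(1) = 1 + Σ c_i is nonzero because 1 + λ is invertible; otherwise
  -- multiplication by λ would preserve the parity and 1 = ρρ⁻¹ would have
  -- even parity
  par-c : par c ≡ false
  par-c with par c in par-c≡
  ... | false = refl
  ... | true  = ⊥-elim (true≢false (begin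
        true                         ≡⟨ cong (true xor_) (par-𝟎 (suc (suc k))) ⟨
        par 1F                       ≡⟨ cong par (inverseʳ ρ ρ≢0) ⟨
        par (ρ *F b)                 ≡⟨ cong par (ρ*≡ b) ⟩
        par (b ⊕ mulλ b)             ≡⟨ par-⊕ b (mulλ b) ⟩
        par b xor par (mulλ b)       ≡⟨ cong (par b xor_) mulλ-keeps-par ⟩
        par b xor par b              ≡⟨ xor-same (par b) ⟩
        false                        ∎))
    where
    b : F
    b = ρ ⁻¹⟨ ρ≢0 ⟩
    true≢false : true ≢ false
    true≢false ()
    mulλ-keeps-par : par (mulλ b) ≡ par b
    mulλ-keeps-par rewrite mulλ-par b | par-c≡ | ∧-identityʳ (coord b top) = xor-cancelʳ (par b) (coord b top)

  mulλ-top : ∀ y → coord (mulλ y) top ≡ coord y (suc k)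
  mulλ-top y rewrite mulλ-coordSuc y (suc k) ≤-refl | c-top | ∧-zeroʳ (coord y top) = xor-identityʳ _

  mulλ-sub : ∀ y → coord (mulλ y) (suc k) ≡ coord y k
  mulλ-sub y rewrite mulλ-coordSuc y k (n≤1+n _) | c-sub | ∧-zeroʳ (coord y top) = xor-identityʳ _

  mulλ-par′ : ∀ y → par (mulλ y) ≡ par y xor coord y top
  mulλ-par′ y rewrite mulλ-par y | par-c | ∧-zeroʳ (coord y top) = xor-identityʳ _

  sumUpTo-top : ∀ μ → sumUpTo μ (suc k) ≡ par μ xor coord μ top
  sumUpTo-top μ = xor-solveʳ (sumUpTo-last {top} μ)

  sumUpTo-sub : ∀ μ → sumUpTo μ k ≡ (par μ xor coord μ top) xor coord μ (suc k)
  sumUpTo-sub μ = xor-solveʳ (xor-solveʳ (sumUpTo-last2 {suc k} μ))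

  δ : F
  δ = λF *F ρ

  δ≢0 : δ ≢ 0F
  δ≢0 = *-nonzero λF ρ λ≢0 ρ≢0

  λ-top : ∀ μ → coord (λF *F μ) top ≡ coord μ (suc k)
  λ-top μ = trans (cong (λ y → coord y top) (λ*≡mulλ μ)) (mulλ-top μ)

  λ-par : ∀ μ → par (λF *F μ) ≡ par μ xor coord μ top
  λ-par μ = trans (cong par (λ*≡mulλ μ)) (mulλ-par′ μ)

  ρ-top : ∀ μ → coord (ρ *F μ) top ≡ coord μ top xor coord μ (suc k)
  ρ-top μ rewrite ρ*≡ μ | coord-⊕ μ (mulλ μ) top | mulλ-top μ = refl

  ρ-sub : ∀ μ → coord (ρ *F μ) (suc k) ≡ coord μ (suc k) xor coord μ k
  ρ-sub μ rewrite ρ*≡ μ | coord-⊕ μ (mulλ μ) (suc k) | mulλ-sub μ = refl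

  ρ-par : ∀ μ → par (ρ *F μ) ≡ coord μ top
  ρ-par μ rewrite ρ*≡ μ | par-⊕ μ (mulλ μ) | mulλ-par′ μ = xor-cancelˡ (par μ) (coord μ top)

  δ-top : ∀ μ → coord (δ *F μ) top ≡ coord μ (suc k) xor coord μ k
  δ-top μ rewrite *-assoc λF ρ μ | λ-top (ρ *F μ) = ρ-sub μ

  δ-par : ∀ μ → par (δ *F μ) ≡ coord μ (suc k)
  δ-par μ rewrite *-assoc λF ρ μ | λ-par (ρ *F μ) | ρ-par μ | ρ-top μ = xor-cancelˡ (coord μ top) (coord μ (suc k))

  u : V
  u = 0F , 1F , λF

  u≢0 : Nz u
  u≢0 u≡0 = 1≢0 (cong (λ w → proj₁ (proj₂ w)) u≡0)

  -- the z-coordinate α + βλ of a normal vector of type (α, β)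
  τ : Bool → Bool → F
  τ α β = α · 1F ⊕ β · λF

  τ-⊕ : ∀ α β α′ β′ → τ (α xor α′) (β xor β′) ≡ τ α β ⊕ τ α′ β′
  τ-⊕ α β α′ β′ rewrite ·-distrib-xor α α′ 1F | ·-distrib-xor β β′ λF = ⊕-interchange _ _ _ _

  -- (x, y, z) is the representative with u·w = δ of a point of A_c off the
  -- axis; its type (α, β) records which of S_A, S_C, S_E, S_B it comes from
  record IsNormal (x y z : F) : Set where
    constructor normal
    field
      α β    : Bool
      z-form : z ≡ τ α β
      y-form : y ≡ δ ⊕ (λF *F z)
      x-top  : coord x top ≡ not (α xor β)
      x-par  : par x ≡ (α xor β) ∧ cc

  Normal : V → Set
  Normal (x , y , z) = IsNormal x y z

  dot-normal : ∀ w → Normal w → dot u w ≡ δ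
  dot-normal (x , y , z) (normal _ _ _ refl _ _) = begin
    ((0F *F x) ⊕ (1F *F y)) ⊕ (λF *F z) ≡⟨ cong₂ (λ a b → (a ⊕ b) ⊕ (λF *F z)) (*-zeroˡ x) (*-identityˡ y) ⟩
    (0F ⊕ y) ⊕ (λF *F z)                ≡⟨ cong (_⊕ (λF *F z)) (⊕-identityˡ y) ⟩
    (δ ⊕ (λF *F z)) ⊕ (λF *F z)         ≡⟨ ⊕-cancelʳ δ (λF *F z) ⟩
    δ                                   ∎

  -- all defining conditions are affine over F_2, so normal vectors are closed
  -- under sums of three
  normal-sum3 : ∀ w₁ w₂ w₃ → Normal w₁ → Normal w₂ → Normal w₃ → Normal (w₃ +V (w₁ +V w₂))
  normal-sum3 (x₁ , _ , _) (x₂ , _ , _) (x₃ , _ , _)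
      (normal α₁ β₁ refl refl t₁ p₁) (normal α₂ β₂ refl refl t₂ p₂) (normal α₃ β₃ refl refl t₃ p₃) =
    normal α β z-form y-form x-top x-par
    where
    α = α₃ xor (α₁ xor α₂)
    β = β₃ xor (β₁ xor β₂)
    s₁ = α₁ xor β₁
    s₂ = α₂ xor β₂
    s₃ = α₃ xor β₃
    type-sum : s₃ xor (s₁ xor s₂) ≡ α xor β
    type-sum = trans (cong (s₃ xor_) (xor-interchange α₁ β₁ α₂ β₂)) (xor-interchange α₃ β₃ _ _)
    z-form : τ α₃ β₃ ⊕ (τ α₁ β₁ ⊕ τ α₂ β₂) ≡ τ α β
    z-form = sym (trans (τ-⊕ α₃ β₃ _ _) (cong (τ α₃ β₃ ⊕_) (τ-⊕ α₁ β₁ α₂ β₂)))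
    y-form : (δ ⊕ (λF *F τ α₃ β₃)) ⊕ ((δ ⊕ (λF *F τ α₁ β₁)) ⊕ (δ ⊕ (λF *F τ α₂ β₂)))
           ≡ δ ⊕ (λF *F (τ α₃ β₃ ⊕ (τ α₁ β₁ ⊕ τ α₂ β₂)))
    y-form = trans (⊕-affine-sum3 δ _ _ _) (cong (δ ⊕_) (begin
      (λF *F τ α₃ β₃) ⊕ ((λF *F τ α₁ β₁) ⊕ (λF *F τ α₂ β₂))
        ≡⟨ cong ((λF *F τ α₃ β₃) ⊕_) (*-distribˡ λF (τ α₁ β₁) (τ α₂ β₂)) ⟨
      (λF *F τ α₃ β₃) ⊕ (λF *F (τ α₁ β₁ ⊕ τ α₂ β₂))
        ≡⟨ *-distribˡ λF (τ α₃ β₃) _ ⟨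
      λF *F (τ α₃ β₃ ⊕ (τ α₁ β₁ ⊕ τ α₂ β₂)) ∎))
    x-top : coord (x₃ ⊕ (x₁ ⊕ x₂)) top ≡ not (α xor β)
    x-top = begin
      coord (x₃ ⊕ (x₁ ⊕ x₂)) top                         ≡⟨ coord-⊕ x₃ (x₁ ⊕ x₂) top ⟩
      coord x₃ top xor coord (x₁ ⊕ x₂) top              ≡⟨ cong (coord x₃ top xor_) (coord-⊕ x₁ x₂ top) ⟩
      coord x₃ top xor (coord x₁ top xor coord x₂ top)  ≡⟨ cong₂ (λ a b → a xor b) t₃ (cong₂ _xor_ t₁ t₂) ⟩
      not s₃ xor (not s₁ xor not s₂)                    ≡⟨ not-sum3 s₃ s₁ s₂ ⟩
      not (s₃ xor (s₁ xor s₂))                          ≡⟨ cong not type-sum ⟩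
      not (α xor β)                                     ∎
    x-par : par (x₃ ⊕ (x₁ ⊕ x₂)) ≡ (α xor β) ∧ cc
    x-par = begin
      par (x₃ ⊕ (x₁ ⊕ x₂))                              ≡⟨ par-⊕ x₃ (x₁ ⊕ x₂) ⟩
      par x₃ xor par (x₁ ⊕ x₂)                          ≡⟨ cong (par x₃ xor_) (par-⊕ x₁ x₂) ⟩
      par x₃ xor (par x₁ xor par x₂)                    ≡⟨ cong₂ _xor_ p₃ (cong₂ _xor_ p₁ p₂) ⟩
      (s₃ ∧ cc) xor ((s₁ ∧ cc) xor (s₂ ∧ cc))           ≡⟨ cong ((s₃ ∧ cc) xor_) (∧-distribʳ-xor cc s₁ s₂) ⟨
      (s₃ ∧ cc) xor ((s₁ xor s₂) ∧ cc)                  ≡⟨ ∧-distribʳ-xor cc s₃ (s₁ xor s₂) ⟨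
      (s₃ xor (s₁ xor s₂)) ∧ cc                         ≡⟨ cong (_∧ cc) type-sum ⟩
      (α xor β) ∧ cc                                    ∎

  τ-ff : τ false false ≡ 0F
  τ-ff = ⊕-identityʳ 0F

  τ-ft : τ false true ≡ λF
  τ-ft = ⊕-identityˡ λF

  τ-tf : τ true false ≡ 1F
  τ-tf = ⊕-identityʳ 1F

  δ≡λ+λ² : δ ≡ λF ⊕ λ²
  δ≡λ+λ² = trans (*-distribˡ λF 1F λF) (cong (_⊕ λ²) (*-identityʳ λF))

  y-ff : δ ⊕ (λF *F τ false false) ≡ δ
  y-ff = begin
    δ ⊕ (λF *F τ false false) ≡⟨ cong (λ z → δ ⊕ (λF *F z)) τ-ff ⟩
    δ ⊕ (λF *F 0F)            ≡⟨ cong (δ ⊕_) (*-zeroʳ λF) ⟩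
    δ ⊕ 0F                    ≡⟨ ⊕-identityʳ δ ⟩
    δ                         ∎

  y-tt : δ ⊕ (λF *F τ true true) ≡ 0F
  y-tt = ⊕-self δ

  y-ft : δ ⊕ (λF *F τ false true) ≡ λF
  y-ft = begin
    δ ⊕ (λF *F τ false true)  ≡⟨ cong₂ (λ d z → d ⊕ (λF *F z)) δ≡λ+λ² τ-ft ⟩
    (λF ⊕ λ²) ⊕ λ²            ≡⟨ ⊕-cancelʳ λF λ² ⟩
    λF                        ∎

  y-tf : δ ⊕ (λF *F τ true false) ≡ λ²
  y-tf = begin
    δ ⊕ (λF *F τ true false)  ≡⟨ cong₂ (λ d z → d ⊕ (λF *F z)) δ≡λ+λ² τ-tf ⟩
    (λF ⊕ λ²) ⊕ (λF *F 1F)    ≡⟨ cong₂ _⊕_ (⊕-comm λF λ²) (*-identityʳ λF) ⟩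
    (λ² ⊕ λF) ⊕ λF            ≡⟨ ⊕-cancelʳ λ² λF ⟩
    λ²                        ∎

  scaled-normal : ∀ m μ y₀ z₀ α β → m *F z₀ ≡ τ α β → m *F y₀ ≡ δ ⊕ (λF *F τ α β) →
    coord (m *F μ) top ≡ not (α xor β) → par (m *F μ) ≡ (α xor β) ∧ cc → Normal (scale m (μ , y₀ , z₀))
  scaled-normal m μ y₀ z₀ α β mz≡ my≡ x-top x-par =
    normal α β mz≡ (trans my≡ (cong (λ z → δ ⊕ (λF *F z)) (sym mz≡))) x-top x-par

  normal-A : ∀ μ → coord μ (suc k) ≡ false → coord μ k ≡ true → Normal (scale δ (μ , 1F , 0F))
  normal-A μ μ₂ μ₃ = scaled-normal δ μ 1F 0F false false
    (trans (*-zeroʳ δ) (sym τ-ff)) (trans (*-identityʳ δ) (sym y-ff))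
    (trans (δ-top μ) (cong₂ _xor_ μ₂ μ₃)) (trans (δ-par μ) μ₂)

  normal-B : ∀ μ → coord μ top ≡ false → coord μ (suc k) ≡ true → Normal (scale ρ (μ , 0F , 1F))
  normal-B μ μ₁ μ₂ = scaled-normal ρ μ 0F 1F true true
    (*-identityʳ ρ) (trans (*-zeroʳ ρ) (sym y-tt))
    (trans (ρ-top μ) (cong₂ _xor_ μ₁ μ₂)) (trans (ρ-par μ) μ₁)

  normal-C : ∀ μ → coord μ (suc k) ≡ false → sumUpTo μ k ≡ cc → Normal (scale λF (μ , 1F , 1F))
  normal-C μ μ₂ μ-sum = scaled-normal λF μ 1F 1F false true
    (trans (*-identityʳ λF) (sym τ-ft)) (trans (*-identityʳ λF) (sym y-ft))
    (trans (λ-top μ) μ₂) (begin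
      par (λF *F μ)                                  ≡⟨ λ-par μ ⟩
      par μ xor coord μ top                          ≡⟨ xor-identityʳ _ ⟨
      (par μ xor coord μ top) xor false              ≡⟨ cong ((par μ xor coord μ top) xor_) μ₂ ⟨
      (par μ xor coord μ top) xor coord μ (suc k)    ≡⟨ sumUpTo-sub μ ⟨
      sumUpTo μ k                                    ≡⟨ μ-sum ⟩
      cc                                             ∎)

  normal-E : ∀ μ → coord μ top ≡ false → sumUpTo μ (suc k) ≡ cc → Normal (scale 1F (μ , λ² , 1F))
  normal-E μ μ₁ μ-sum = scaled-normal 1F μ λ² 1F true false
    (trans (*-identityˡ 1F) (sym τ-tf)) (trans (*-identityˡ λ²) (sym y-tf))
    (trans (cong (λ v → coord v top) (*-identityˡ μ)) μ₁) (begin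
      par (1F *F μ)               ≡⟨ cong par (*-identityˡ μ) ⟩
      par μ                       ≡⟨ xor-identityʳ (par μ) ⟨
      par μ xor false             ≡⟨ cong (par μ xor_) μ₁ ⟨
      par μ xor coord μ top       ≡⟨ sumUpTo-top μ ⟨
      sumUpTo μ (suc k)           ≡⟨ μ-sum ⟩
      cc                          ∎)

  S_D-on-axis : ∀ μ → dot u (μ , λF , 1F) ≡ 0F
  S_D-on-axis μ = begin
    ((0F *F μ) ⊕ (1F *F λF)) ⊕ (λF *F 1F) ≡⟨ cong₂ (λ a b → (a ⊕ b) ⊕ (λF *F 1F)) (*-zeroˡ μ) (*-identityˡ λF) ⟩
    (0F ⊕ λF) ⊕ (λF *F 1F)                ≡⟨ cong₂ _⊕_ (⊕-identityˡ λF) (*-identityʳ λF) ⟩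
    λF ⊕ λF                               ≡⟨ ⊕-self λF ⟩
    0F                                    ∎

  unscale : ∀ m (m≢0 : m ≢ 0F) x {y z y₀ z₀} → m *F y₀ ≡ y → m *F z₀ ≡ z →
    (x , y , z) ∼ (m ⁻¹⟨ m≢0 ⟩ *F x , y₀ , z₀)
  unscale m m≢0 x {y₀ = y₀} {z₀} refl refl =
    m ⁻¹⟨ m≢0 ⟩ , inverse≢0 m m≢0 , cong₂ _,_ refl (cong₂ _,_ (inverse-cancel m m≢0 y₀) (inverse-cancel m m≢0 z₀))

  normal⇒arc : ∀ w → Normal w → Arc cc w
  normal⇒arc (x , _ , _) (normal false false refl refl x-top x-par) =
    inj₁ (μ , μ₂ , μ₃ , unscale δ δ≢0 x (trans (*-identityʳ δ) (sym y-ff)) (trans (*-zeroʳ δ) (sym τ-ff)))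
    where
    μ = δ ⁻¹⟨ δ≢0 ⟩ *F x
    δμ≡x = inverse-cancelʳ δ δ≢0 x
    μ₂ : coord μ (suc k) ≡ false
    μ₂ = trans (sym (δ-par μ)) (trans (cong par δμ≡x) x-par)
    μ₃ : coord μ k ≡ true
    μ₃ = trans (cong (_xor coord μ k) (sym μ₂))
               (trans (sym (δ-top μ)) (trans (cong (λ v → coord v top) δμ≡x) x-top))
  normal⇒arc (x , _ , _) (normal true true refl refl x-top x-par) =
    inj₂ (inj₁ (μ , μ₁ , μ₂ , unscale ρ ρ≢0 x (trans (*-zeroʳ ρ) (sym y-tt)) (*-identityʳ ρ)))
    where
    μ = ρ ⁻¹⟨ ρ≢0 ⟩ *F x
    ρμ≡x = inverse-cancelʳ ρ ρ≢0 x
    μ₁ : coord μ top ≡ false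
    μ₁ = trans (sym (ρ-par μ)) (trans (cong par ρμ≡x) x-par)
    μ₂ : coord μ (suc k) ≡ true
    μ₂ = trans (cong (_xor coord μ (suc k)) (sym μ₁))
               (trans (sym (ρ-top μ)) (trans (cong (λ v → coord v top) ρμ≡x) x-top))
  normal⇒arc (x , _ , _) (normal false true refl refl x-top x-par) =
    inj₂ (inj₂ (inj₁ (μ , μ₂ , μ-sum , unscale λF λ≢0 x (trans (*-identityʳ λF) (sym y-ft)) (trans (*-identityʳ λF) (sym τ-ft)))))
    where
    μ = λF ⁻¹⟨ λ≢0 ⟩ *F x
    λμ≡x = inverse-cancelʳ λF λ≢0 x
    μ₂ : coord μ (suc k) ≡ false
    μ₂ = trans (sym (λ-top μ)) (trans (cong (λ v → coord v top) λμ≡x) x-top)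
    μ-sum : sumUpTo μ k ≡ cc
    μ-sum = begin
      sumUpTo μ k                                  ≡⟨ sumUpTo-sub μ ⟩
      (par μ xor coord μ top) xor coord μ (suc k)  ≡⟨ cong ((par μ xor coord μ top) xor_) μ₂ ⟩
      (par μ xor coord μ top) xor false            ≡⟨ xor-identityʳ _ ⟩
      par μ xor coord μ top                        ≡⟨ λ-par μ ⟨
      par (λF *F μ)                                ≡⟨ cong par λμ≡x ⟩
      par x                                        ≡⟨ x-par ⟩
      cc                                           ∎
  normal⇒arc (x , _ , _) (normal true false refl refl x-top x-par) =
    inj₂ (inj₂ (inj₂ (inj₂ (μ , μ₁ , μ-sum , unscale 1F 1≢0 x (trans (*-identityˡ λ²) (sym y-tf)) (trans (*-identityˡ 1F) (sym τ-tf))))))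
    where
    μ = 1F ⁻¹⟨ 1≢0 ⟩ *F x
    μ≡x : μ ≡ x
    μ≡x = trans (sym (*-identityˡ μ)) (inverse-cancelʳ 1F 1≢0 x)
    μ₁ : coord μ top ≡ false
    μ₁ = trans (cong (λ v → coord v top) μ≡x) x-top
    μ-sum : sumUpTo μ (suc k) ≡ cc
    μ-sum = begin
      sumUpTo μ (suc k)         ≡⟨ sumUpTo-top μ ⟩
      par μ xor coord μ top     ≡⟨ cong (par μ xor_) μ₁ ⟩
      par μ xor false           ≡⟨ xor-identityʳ (par μ) ⟩
      par μ                     ≡⟨ cong par μ≡x ⟩
      par x                     ≡⟨ x-par ⟩
      cc                        ∎

  rescale : ∀ {m t p} w → scale t w ≡ p → Normal (scale m p) → Normal (scale (m *F t) w)
  rescale {m} {t} w t·w≡p = subst Normal (trans (cong (scale m) (sym t·w≡p)) (scale-∘ m t w))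

  arc⇒normal : ∀ w → Arc cc w → OnLine u w ⊎ Σ F (λ t → t ≢ 0F × Normal (scale t w))
  arc⇒normal w (inj₁ (μ , μ₂ , μ₃ , t , t≢0 , t·w≡)) =
    inj₂ (δ *F t , *-nonzero δ t δ≢0 t≢0 , rescale w t·w≡ (normal-A μ μ₂ μ₃))
  arc⇒normal w (inj₂ (inj₁ (μ , μ₁ , μ₂ , t , t≢0 , t·w≡))) =
    inj₂ (ρ *F t , *-nonzero ρ t ρ≢0 t≢0 , rescale w t·w≡ (normal-B μ μ₁ μ₂))
  arc⇒normal w (inj₂ (inj₂ (inj₁ (μ , μ₂ , μ-sum , t , t≢0 , t·w≡)))) =
    inj₂ (λF *F t , *-nonzero λF t λ≢0 t≢0 , rescale w t·w≡ (normal-C μ μ₂ μ-sum))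
  arc⇒normal w (inj₂ (inj₂ (inj₂ (inj₁ (μ , _ , _ , t , t≢0 , t·w≡))))) =
    inj₁ (*-cancel-zero t (dot u w) t≢0 (trans (sym (dot-scale u t w)) (trans (cong (dot u) t·w≡) (S_D-on-axis μ))))
  arc⇒normal w (inj₂ (inj₂ (inj₂ (inj₂ (μ , μ₁ , μ-sum , t , t≢0 , t·w≡))))) =
    inj₂ (1F *F t , *-nonzero 1F t 1≢0 t≢0 , rescale w t·w≡ (normal-E μ μ₁ μ-sum))

  ∼-rescale : ∀ {x w p} t → t ≢ 0F → scale t x ≡ w → w ∼ p → x ∼ p
  ∼-rescale {x} t t≢0 t·x≡w (s , s≢0 , s·w≡p) =
    s *F t , *-nonzero s t s≢0 t≢0 , trans (sym (scale-∘ s t x)) (trans (cong (scale s) t·x≡w) s·w≡p)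

  arc-rescale : ∀ {x w} t → t ≢ 0F → scale t x ≡ w → Arc cc w → Arc cc x
  arc-rescale {x} t t≢0 eq (inj₁ (μ , a , b , r)) = inj₁ (μ , a , b , ∼-rescale {x} t t≢0 eq r)
  arc-rescale {x} t t≢0 eq (inj₂ (inj₁ (μ , a , b , r))) = inj₂ (inj₁ (μ , a , b , ∼-rescale {x} t t≢0 eq r))
  arc-rescale {x} t t≢0 eq (inj₂ (inj₂ (inj₁ (μ , a , b , r)))) =
    inj₂ (inj₂ (inj₁ (μ , a , b , ∼-rescale {x} t t≢0 eq r)))
  arc-rescale {x} t t≢0 eq (inj₂ (inj₂ (inj₂ (inj₁ (μ , a , b , r))))) =
    inj₂ (inj₂ (inj₂ (inj₁ (μ , a , b , ∼-rescale {x} t t≢0 eq r))))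
  arc-rescale {x} t t≢0 eq (inj₂ (inj₂ (inj₂ (inj₂ (μ , a , b , r))))) =
    inj₂ (inj₂ (inj₂ (inj₂ (μ , a , b , ∼-rescale {x} t t≢0 eq r))))

  centre : V → V → V
  centre w₁ w₂ = scale (δ ⁻¹⟨ δ≢0 ⟩) (w₁ +V w₂)

  centre-on-axis : ∀ w₁ w₂ → Normal w₁ → Normal w₂ → OnLine u (centre w₁ w₂)
  centre-on-axis w₁ w₂ N₁ N₂ = begin
    dot u (scale δ⁻¹ (w₁ +V w₂))  ≡⟨ dot-scale u δ⁻¹ (w₁ +V w₂) ⟩
    δ⁻¹ *F dot u (w₁ +V w₂)       ≡⟨ cong (δ⁻¹ *F_) (dot-+V u w₁ w₂) ⟩
    δ⁻¹ *F (dot u w₁ ⊕ dot u w₂)  ≡⟨ cong (δ⁻¹ *F_) (cong₂ _⊕_ (dot-normal w₁ N₁) (dot-normal w₂ N₂)) ⟩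
    δ⁻¹ *F (δ ⊕ δ)                ≡⟨ cong (δ⁻¹ *F_) (⊕-self δ) ⟩
    δ⁻¹ *F 0F                     ≡⟨ *-zeroʳ δ⁻¹ ⟩
    0F                            ∎
    where δ⁻¹ = δ ⁻¹⟨ δ≢0 ⟩

  elation-normal : ∀ w₁ w₂ w → Normal w → elation u (centre w₁ w₂) w ≡ w +V (w₁ +V w₂)
  elation-normal w₁ w₂ w N = cong (w +V_) (begin
    scale (dot u w) (scale δ⁻¹ (w₁ +V w₂)) ≡⟨ cong (λ s → scale s (scale δ⁻¹ (w₁ +V w₂))) (dot-normal w N) ⟩
    scale δ (scale δ⁻¹ (w₁ +V w₂))         ≡⟨ scale-∘ δ δ⁻¹ (w₁ +V w₂) ⟩
    scale (δ *F δ⁻¹) (w₁ +V w₂)            ≡⟨ cong (λ s → scale s (w₁ +V w₂)) (inverseʳ δ δ≢0) ⟩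
    scale 1F (w₁ +V w₂)                    ≡⟨ scale-one (w₁ +V w₂) ⟩
    w₁ +V w₂                               ∎)
    where δ⁻¹ = δ ⁻¹⟨ δ≢0 ⟩

  -- the elation maps A_c into itself: points on the axis are fixed, and the
  -- normal representative w of any other point goes to w + w₁ + w₂
  elation-into-arc : ∀ w₁ w₂ → Normal w₁ → Normal w₂ → ∀ z → Arc cc z → Arc cc (elation u (centre w₁ w₂) z)
  elation-into-arc w₁ w₂ N₁ N₂ z z∈A = by-cases (arc⇒normal z z∈A)
    where
    g : V → V
    g = elation u (centre w₁ w₂)
    by-cases : OnLine u z ⊎ Σ F (λ t → t ≢ 0F × Normal (scale t z)) → Arc cc (g z)
    by-cases (inj₁ z∈u) = subst (Arc cc) (sym (elation-axis u (centre w₁ w₂) z z∈u)) z∈A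
    by-cases (inj₂ (t , t≢0 , N)) = arc-rescale {g z} {g (scale t z)} t t≢0 (sym (elation-scale u (centre w₁ w₂) t z))
      (normal⇒arc (g (scale t z)) g[tz]-normal)
      where
      g[tz]-normal : Normal (g (scale t z))
      g[tz]-normal = subst Normal (sym (elation-normal w₁ w₂ (scale t z) N)) (normal-sum3 w₁ w₂ (scale t z) N₁ N₂ N)

  elation-fixes-arc : ∀ w₁ w₂ → Normal w₁ → Normal w₂ → Fixes (elation u (centre w₁ w₂)) (Arc cc)
  elation-fixes-arc w₁ w₂ N₁ N₂ z _ =
    elation-into-arc w₁ w₂ N₁ N₂ z ,
    λ gz∈A → subst (Arc cc) (elation-involutive u (centre w₁ w₂) (centre-on-axis w₁ w₂ N₁ N₂) z)
                   (elation-into-arc w₁ w₂ N₁ N₂ (elation u (centre w₁ w₂) z) gz∈A)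

  elation-moves : ∀ x y t₁ t₂ → t₁ ≢ 0F → (t₂≢0 : t₂ ≢ 0F) → (N₁ : Normal (scale t₁ x)) → Normal (scale t₂ y) →
    elation u (centre (scale t₁ x) (scale t₂ y)) x ∼ y
  elation-moves x y t₁ t₂ t₁≢0 t₂≢0 N₁ _ = t₂⁻¹ *F t₁ , *-nonzero t₂⁻¹ t₁ (inverse≢0 t₂ t₂≢0) t₁≢0 , (begin
    scale (t₂⁻¹ *F t₁) (g x)    ≡⟨ scale-∘ t₂⁻¹ t₁ (g x) ⟨
    scale t₂⁻¹ (scale t₁ (g x)) ≡⟨ cong (scale t₂⁻¹) t₁gx≡w₂ ⟩
    scale t₂⁻¹ (scale t₂ y)     ≡⟨ scale-∘ t₂⁻¹ t₂ y ⟩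
    scale (t₂⁻¹ *F t₂) y        ≡⟨ cong (λ s → scale s y) (inverseˡ t₂ t₂≢0) ⟩
    scale 1F y                  ≡⟨ scale-one y ⟩
    y                           ∎)
    where
    t₂⁻¹ = t₂ ⁻¹⟨ t₂≢0 ⟩
    w₁ = scale t₁ x
    w₂ = scale t₂ y
    g = elation u (centre w₁ w₂)
    t₁gx≡w₂ : scale t₁ (g x) ≡ w₂
    t₁gx≡w₂ = begin
      scale t₁ (g x)    ≡⟨ elation-scale u (centre w₁ w₂) t₁ x ⟨
      g w₁              ≡⟨ elation-normal w₁ w₂ w₁ N₁ ⟩
      w₁ +V (w₁ +V w₂)  ≡⟨ +V-cancelˡ w₁ w₂ ⟩
      w₂                ∎

  arc-translation : IsTranslationSetWrt u (Arc cc)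
  arc-translation x y _ _ x∈A y∈A x∉u y∉u with arc⇒normal x x∈A | arc⇒normal y y∈A
  ... | inj₁ x∈u | _        = ⊥-elim (x∉u x∈u)
  ... | inj₂ _   | inj₁ y∈u = ⊥-elim (y∉u y∈u)
  ... | inj₂ (t₁ , t₁≢0 , N₁) | inj₂ (t₂ , t₂≢0 , N₂) =
    centre (scale t₁ x) (scale t₂ y) ,
    centre-on-axis (scale t₁ x) (scale t₂ y) N₁ N₂ ,
    elation-fixes-arc (scale t₁ x) (scale t₂ y) N₁ N₂ ,
    elation-moves x y t₁ t₂ t₁≢0 t₂≢0 N₁ N₂

lemma3p10 : (h : ℕ) → 3 ≤ h → (c : Vec Bool h)
    → coord c (h ∸ 1) ≡ false → coord c (h ∸ 2) ≡ false
    → Field.IsPrimitive c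
    → (cc : Bool)
    → Field.IsKMArc c (2 ^ (h ∸ 2)) (Field.Arc c cc)
    → Field.IsTranslationKMArc c (Field.Arc c cc)
lemma3p10 (suc (suc (suc k))) (s≤s (s≤s (s≤s z≤n))) c c-top c-sub prim cc km-arc =
  (2 ^ suc k , km-arc) , u , u≢0 , arc-translation
  where open TranslationArc c c-top c-sub prim cc
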